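{- Let $n\ge 3$. Then (i) $C_n=\mathcal{E}_\sigma\oplus \mathcal{A}^{C}_n$ and (ii) $D_n=\mathcal{E}_\sigma\oplus\mathcal{A}^{D}_n$, where $\oplus$ is symmetric difference and all objects are as in the context.
   Context: Permutation strings $\mathbf{p}=p_0\cdots p_{n-1}$ of $\{1,\dots,n\}$; $\mathbf{p}\sigma=p_1\cdots p_{n-1}p_0$, $\mathbf{p}\sigma^{ -1}=p_{n-1}p_0\cdots p_{n-2}$, $\mathbf{p}\tau=p_1p_0p_2\cdots p_{n-1}$, applied left to right. $\Gamma_n$: digraph on permutation strings with arcs $(\mathbf{p},\mathbf{p}\sigma)$ (forming $\mathcal{E}_\sigma$) and $(\mathbf{p},\mathbf{p}\tau)$. For a vertex $\mathbf{p}$ let $i$ be the index with $p_i=n$ and $r=p_{(i\bmod n-1)+1}$. $C_n$: for each $\mathbf{p}$, $(\mathbf{p}\tau,\mathbf{p})\in C_n$ if (a) $r<n-1$ and $r=p_0-1$, or (b) $r=n-1$ and $p_0=2$, or (c) $p_1\cdots p_{n-1}$ is a rotation of $1\,2\cdots n{ - }1$; otherwise $(\mathbf{p}\sigma^{ -1},\mathbf{p})\in C_n$. $D_n$: for each $\mathbf{p}$, $(\mathbf{p}\tau,\mathbf{p})\in D_n$ if (a) $r<n-1$ and $r=p_0-1$, or (b) $r=n-1$ and $p_0=1$; otherwise $(\mathbf{p}\sigma^{ -1},\mathbf{p})\in D_n$. Alternating cycles: for a permutation string $\mathbf{p}$, its alternating-cycle arc set is $\{(\mathbf{x}_j,\mathbf{x}_j\tau),(\mathbf{x}_{j+1},\mathbf{x}_j\tau):0\le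 j\le n-2\}$ with $\mathbf{x}_0=\mathbf{p}$, $\mathbf{x}_{j+1}=\mathbf{x}_j\tau\sigma^{ -1}$. For a string $\mathbf{q}=q_1\cdots q_{n-1}$ of distinct symbols of $\{1,\dots,n\}$ missing the symbol $m$, write $[\mathbf{q}]$ for its class under cyclic rotation and let $a([\mathbf{q}])$ be the alternating-cycle arc set of $q_1\,m\,q_2\cdots q_{n-1}$ (independent of the rotation chosen). For $r\ne m$ in $\{1,\dots,n-1\}$, $R_n(r,m)$ is the set of rotation classes of strings of length $n-1$ of distinct symbols from $\{1,\dots,n\}\setminus\{m\}$ that contain a rotation of the form $n\,r\,p_3\cdots p_{n-1}$. Let $\mathbf{Y}^C_n=R_n(1,2)\cup R_n(2,3)\cup\cdots\cup R_n(n{ - }2,n{ - }1)\cup R_n(n{ - }1,2)\cup\{[1\,2\cdots n{ - }1]\}$ and $\mathbf{Y}^D_n=R_n(1,2)\cup R_n(2,3)\cup\cdots\cup R_n(n{ - }2,n{ - }1)\cup R_n(n{ - }1,1)$. $\mathcal{A}^C_n=\bigcup_{Y\in\mathbf{Y}^C_n}a(Y)$ and $\mathcal{A}^D_n=\bigcup_{Y\in\mathbf{Y}^D_n}a(Y)$. -}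

module Defs where

open import Data.Nat using (ℕ; zero; suc; _+_; _∸_; _≤_; _<_)
open import Data.Nat.DivMod using (_%_)
open import Data.Nat.Properties using (_≟_)
open import Data.List using (List; []; _∷_; _++_; [_]; reverse; map; upTo)
open import Data.Maybe using (Maybe; just; nothing)
open import Data.List.Relation.Binary.Permutation.Propositional using (_↭_)
open import Data.Product using (Σ; _×_; _,_)
open import Data.Sum using (_⊎_)
open import Relation.Nullary using (¬_; yes; no)
open import Relation.Binary.PropositionalEquality using (_≡_)
open import Function using (_∘_)

-- Strings are lists of naturals; symbols are 1..n.

range : ℕ → List ℕ
range n = map suc (upTo n)

IsPerm : ℕ → List ℕ → Set
IsPerm n p = p ↭ range n

-- p σ = p1 ... p_{n-1} p0  (rotate left)
rotL : List ℕ → List ℕ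
rotL []       = []
rotL (x ∷ xs) = xs ++ [ x ]

rotR : List ℕ → List ℕ
rotR l with reverse l
... | []      = []
... | x ∷ r   = x ∷ reverse r

-- p τ = p1 p0 p2 ... p_{n-1}
swap01 : List ℕ → List ℕ
swap01 (a ∷ b ∷ xs) = b ∷ a ∷ xs
swap01 l            = l

iter : ℕ → (List ℕ → List ℕ) → List ℕ → List ℕ
iter zero    f x = x
iter (suc k) f x = f (iter k f x)

IsRotation : List ℕ → List ℕ → Set
IsRotation q q' = Σ ℕ λ k → iter k rotL q ≡ q'

-- 0-based index of the first occurrence of a symbol (irrelevant default if absent)
indexOf : ℕ → List ℕ → ℕ
indexOf a []       = zero
indexOf a (x ∷ xs) with a ≟ x
... | yes _ = zero
... | no  _ = suc (indexOf a xs)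

-- p_i (0-based), default 0 out of range
at : List ℕ → ℕ → ℕ
at []       _       = zero
at (x ∷ xs) zero    = x
at (x ∷ xs) (suc i) = at xs i

-- r = p_{(i mod (n-1)) + 1} where p_i = n ;  for n ≥ 3, n-1 = suc (n ∸ 2)
rOf : ℕ → List ℕ → ℕ
rOf n p = at p (suc (indexOf n p % suc (n ∸ 2)))

drop1 : List ℕ → List ℕ
drop1 []       = []
drop1 (_ ∷ xs) = xs

p0 : List ℕ → ℕ
p0 p = at p zero

ArcSet : Set₁
ArcSet = List ℕ → List ℕ → Set

Eσ : ℕ → ArcSet
Eσ n x y = IsPerm n x × y ≡ rotL x

condC : ℕ → List ℕ → Set
condC n p =
  (rOf n p < n ∸ 1 × rOf n p ≡ p0 p ∸ 1)
  ⊎ (rOf n p ≡ n ∸ 1 × p0 p ≡ 2)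
  ⊎ IsRotation (range (n ∸ 1)) (drop1 p)

condD : ℕ → List ℕ → Set
condD n p =
  (rOf n p < n ∸ 1 × rOf n p ≡ p0 p ∸ 1)
  ⊎ (rOf n p ≡ n ∸ 1 × p0 p ≡ 1)

ruleSet : (List ℕ → Set) → ℕ → ArcSet
ruleSet cond n x y =
  IsPerm n y × ((cond y × x ≡ swap01 y) ⊎ (¬ cond y × x ≡ rotR y))

Cn : ℕ → ArcSet
Cn n = ruleSet (condC n) n

Dn : ℕ → ArcSet
Dn n = ruleSet (condD n) n

xs : List ℕ → ℕ → List ℕ
xs p j = iter j (rotR ∘ swap01) p

altCycle : ℕ → List ℕ → ArcSet
altCycle n p x y = Σ ℕ λ j → j ≤ n ∸ 2 ×
  ((x ≡ xs p j × y ≡ swap01 (xs p j))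
   ⊎ (x ≡ xs p (suc j) × y ≡ swap01 (xs p j)))

insert1 : ℕ → List ℕ → List ℕ
insert1 m []      = [ m ]
insert1 m (q ∷ r) = q ∷ m ∷ r

-- q is a string of length n-1 of distinct symbols of {1..n} missing m
Missing : ℕ → ℕ → List ℕ → Set
Missing n m q = (m ∷ q) ↭ range n

InR : ℕ → ℕ → ℕ → List ℕ → Set
InR n r m q = Missing n m q × Σ (List ℕ) λ rest → IsRotation q (n ∷ r ∷ rest)

InChain : ℕ → ℕ → List ℕ → Set
InChain n m q = Σ ℕ λ r → 1 ≤ r × r ≤ n ∸ 2 × m ≡ suc r × InR n r m q

InYC : ℕ → ℕ → List ℕ → Set
InYC n m q =
  InChain n m q
  ⊎ (m ≡ 2 × InR n (n ∸ 1) 2 q)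
  ⊎ (m ≡ n × Missing n n q × IsRotation (range (n ∸ 1)) q)

InYD : ℕ → ℕ → List ℕ → Set
InYD n m q =
  InChain n m q
  ⊎ (m ≡ 1 × InR n (n ∸ 1) 1 q)

unionA : (ℕ → ℕ → List ℕ → Set) → ℕ → ArcSet
unionA Y n x y = Σ ℕ λ m → Σ (List ℕ) λ q → Y n m q × altCycle n (insert1 m q) x y

AC : ℕ → ArcSet
AC = unionA InYC

AD : ℕ → ArcSet
AD = unionA InYD

_⊕_ : ArcSet → ArcSet → ArcSet
(S ⊕ T) x y = (S x y × ¬ T x y) ⊎ (T x y × ¬ S x y)

module Submission where

-- The in-arc of a vertex y in C_n (or D_n) is its τ-arc when the condition holds at y, and
-- otherwise its σ⁻¹-arc, which lies in E_σ. The alternating cycle a([q]) of a string q missing m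
-- consists of both in-arcs of every vertex m w with w a rotation of q, and a τ-arc is never a
-- σ-arc because p₁ ≠ p₂. So E_σ ⊕ 𝒜 trades the σ⁻¹-arc for the τ-arc exactly at the vertices
-- m w with [w] ∈ 𝐘, and it remains to see that the condition holds at m w iff [w] ∈ 𝐘. This is
-- because r is the cyclic successor of n in w: it is invariant under rotating w, and
-- [w] ∈ R_n(r′, m) says precisely that r = r′.

open import Defs
open import Data.Nat using (ℕ; zero; suc; _+_; _∸_; _≤_; _<_; z≤n; s≤s)
open import Data.Nat.Properties using (_≟_; +-suc; +-identityʳ; +-comm; suc-injective; ≤-pred; <-irrefl; n≮n; ≤-refl; m<m+n)
open import Data.Nat.DivMod using (_%_; n%n≡0; m<n⇒m%n≡m)
open import Data.List using (List; []; _∷_; _++_; [_]; _∷ʳ_; reverse; upTo; length; initLast; _∷ʳ′_)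
open import Data.List.Properties using (length-map; length-upTo; length-++; reverse-++; reverse-involutive; ∷-injective; ++-assoc; ++-identityʳ)
open import Data.List.Membership.Propositional using (_∈_; _∉_)
open import Data.List.Membership.Propositional.Properties using (∈-∃++; ∈-++⁺ʳ; ∈-map⁻; ∈-map⁺; ∈-upTo⁺; ∈-upTo⁻)
open import Data.List.Relation.Unary.Any using (here; there)
open import Data.List.Relation.Unary.All as All using (_∷_)
open import Data.List.Relation.Unary.AllPairs using (_∷_)
open import Data.List.Relation.Unary.Unique.Propositional using (Unique)
import Data.List.Relation.Unary.Unique.Propositional.Properties as Unique
open import Data.List.Relation.Binary.Permutation.Propositional using (_↭_; refl; prep; ↭-sym; ↭-trans; ↭⇒↭ₛ)
open import Data.List.Relation.Binary.Permutation.Propositional.Properties using (∈-resp-↭; ↭-length; ∷↭∷ʳ)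
import Data.List.Relation.Binary.Permutation.Setoid.Properties as Permutationₛ
open import Data.Product using (_×_; _,_; proj₁; proj₂; ∃₂)
open import Data.Sum using (_⊎_; inj₁; inj₂)
open import Data.Sum.Function.Propositional using (_⊎-⇔_)
open import Data.Empty using (⊥-elim)
open import Relation.Nullary using (¬_; yes; no; contradiction)
open import Relation.Binary.PropositionalEquality using (_≡_; _≢_; refl; sym; trans; cong; subst; subst₂; setoid; module ≡-Reasoning)
open import Function using (_∘_)
open import Function.Bundles using (_⇔_; mk⇔; Equivalence)

open Equivalence using (to; from)

iter-suc : ∀ k (f : List ℕ → List ℕ) x → iter (suc k) f x ≡ iter k f (f x)
iter-suc zero    f x = refl
iter-suc (suc k) f x = cong f (iter-suc k f x)

iter-+ : ∀ a b (f : List ℕ → List ℕ) x → iter (a + b) f x ≡ iter a f (iter b f x)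
iter-+ zero    b f x = refl
iter-+ (suc a) b f x = cong f (iter-+ a b f x)

iter-rotL-split : ∀ k q → ∃₂ λ c d → q ≡ d ++ c × iter k rotL q ≡ c ++ d
iter-rotL-split zero q = q , [] , refl , sym (++-identityʳ q)
iter-rotL-split (suc k) q with iter-rotL-split k q
... | []    , []    , q≡ , e = [] , [] , q≡ , cong rotL e
... | []    , z ∷ d , q≡ , e = d , [ z ] , trans q≡ (cong (z ∷_) (++-identityʳ d)) , cong rotL e
... | z ∷ c , d     , q≡ , e = c , d ∷ʳ z , trans q≡ (sym (++-assoc d [ z ] c)) , trans (cong rotL e) (++-assoc c d [ z ])

iter-rotL-++ : ∀ c d → iter (length c) rotL (c ++ d) ≡ d ++ c
iter-rotL-++ []      d = sym (++-identityʳ d)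
iter-rotL-++ (z ∷ c) d = begin
  iter (suc (length c)) rotL (z ∷ c ++ d) ≡⟨ iter-suc (length c) rotL (z ∷ c ++ d) ⟩
  iter (length c) rotL ((c ++ d) ∷ʳ z)    ≡⟨ cong (iter (length c) rotL) (++-assoc c d [ z ]) ⟩
  iter (length c) rotL (c ++ d ∷ʳ z)      ≡⟨ iter-rotL-++ c (d ∷ʳ z) ⟩
  (d ∷ʳ z) ++ c                           ≡⟨ ++-assoc d [ z ] c ⟩
  d ++ z ∷ c                              ∎
  where open ≡-Reasoning

IsRotation-++ : ∀ c d → IsRotation (c ++ d) (d ++ c)
IsRotation-++ c d = length c , iter-rotL-++ c d

IsRotation-sym : ∀ {q w} → IsRotation q w → IsRotation w q
IsRotation-sym {q} (k , refl) with iter-rotL-split k q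
... | c , d , q≡ , e = subst₂ IsRotation (sym e) (sym q≡) (IsRotation-++ c d)

IsRotation-trans : ∀ {q w u} → IsRotation q w → IsRotation w u → IsRotation q u
IsRotation-trans {q} (k , refl) (l , refl) = l + k , iter-+ l k rotL q

rotL-↭ : ∀ l → rotL l ↭ l
rotL-↭ []      = refl
rotL-↭ (x ∷ l) = ↭-sym (∷↭∷ʳ x l)

IsRotation⇒↭ : ∀ {q w} → IsRotation q w → w ↭ q
IsRotation⇒↭ (zero  , refl) = refl
IsRotation⇒↭ (suc k , refl) = ↭-trans (rotL-↭ _) (IsRotation⇒↭ (k , refl))

rotR-reverse : ∀ l {x r} → reverse l ≡ x ∷ r → rotR l ≡ x ∷ reverse r
rotR-reverse l eq with reverse l
rotR-reverse l refl | _ = refl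

rotR-∷ʳ : ∀ l z → rotR (l ∷ʳ z) ≡ z ∷ l
rotR-∷ʳ l z = trans (rotR-reverse (l ∷ʳ z) (reverse-++ l [ z ])) (cong (z ∷_) (reverse-involutive l))

rotR-rotL : ∀ l → rotR (rotL l) ≡ l
rotR-rotL []      = refl
rotR-rotL (x ∷ l) = rotR-∷ʳ l x

rotL-rotR : ∀ l → rotL (rotR l) ≡ l
rotL-rotR l with initLast l
... | []       = refl
... | l′ ∷ʳ′ z rewrite rotR-∷ʳ l′ z = refl

rotR-↭ : ∀ l → rotR l ↭ l
rotR-↭ l = subst (rotR l ↭_) (rotL-rotR l) (↭-sym (rotL-↭ (rotR l)))

∷-as-∷ʳ : ∀ (c : ℕ) q → ∃₂ λ u z → c ∷ q ≡ u ∷ʳ z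
∷-as-∷ʳ c []      = [] , c , refl
∷-as-∷ʳ c (d ∷ q) with ∷-as-∷ʳ d q
... | u , z , e = c ∷ u , z , cong (c ∷_) e

altCycle-vertex : ∀ m c q j → ∃₂ λ c′ q′ →
  IsRotation (c ∷ q) (c′ ∷ q′) × xs (insert1 m (c ∷ q)) j ≡ c′ ∷ m ∷ q′
altCycle-vertex m c q zero = c , q , (0 , refl) , refl
altCycle-vertex m c q (suc j) with altCycle-vertex m c q j
... | c′ , q′ , ρ , e with ∷-as-∷ʳ c′ q′
... | u , z , e′ = z , u , IsRotation-trans ρ ρ′ , (begin
  rotR (swap01 (xs (insert1 m (c ∷ q)) j)) ≡⟨ cong (rotR ∘ swap01) e ⟩
  rotR (m ∷ c′ ∷ q′)                       ≡⟨ cong (rotR ∘ (m ∷_)) e′ ⟩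
  rotR ((m ∷ u) ∷ʳ z)                      ≡⟨ rotR-∷ʳ (m ∷ u) z ⟩
  z ∷ m ∷ u                                ∎)
  where
  open ≡-Reasoning
  ρ′ : IsRotation (c′ ∷ q′) (z ∷ u)
  ρ′ = subst (λ v → IsRotation v (z ∷ u)) (sym e′) (IsRotation-++ u [ z ])

altCycle-arc : ∀ {n m c q x y} → altCycle n (insert1 m (c ∷ q)) x y → ∃₂ λ c′ q′ →
  IsRotation (c ∷ q) (c′ ∷ q′) × y ≡ m ∷ c′ ∷ q′ × (x ≡ c′ ∷ m ∷ q′ ⊎ x ≡ rotR (m ∷ c′ ∷ q′))
altCycle-arc {m = m} {c} {q} (j , _ , arc) with altCycle-vertex m c q j
... | c′ , q′ , ρ , e with arc
... | inj₁ (refl , refl) = c′ , q′ , ρ , cong swap01 e , inj₁ e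
... | inj₂ (refl , refl) = c′ , q′ , ρ , cong swap01 e , inj₂ (cong (rotR ∘ swap01) e)

swap01∈altCycle : ∀ n m b t → altCycle n (insert1 m (b ∷ t)) (swap01 (m ∷ b ∷ t)) (m ∷ b ∷ t)
swap01∈altCycle n m b t = 0 , z≤n , inj₁ (refl , refl)

rotR∈altCycle : ∀ n m b t → altCycle n (insert1 m (b ∷ t)) (rotR (m ∷ b ∷ t)) (m ∷ b ∷ t)
rotR∈altCycle n m b t = 0 , z≤n , inj₂ (refl , refl)

length-range : ∀ n → length (range n) ≡ n
length-range n = trans (length-map suc (upTo n)) (length-upTo n)

∈-range⁻ : ∀ {n x} → x ∈ range n → 1 ≤ x × x ≤ n
∈-range⁻ x∈ with ∈-map⁻ suc x∈
... | _ , y∈ , refl = s≤s z≤n , ∈-upTo⁻ y∈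

∈-range⁺ : ∀ n → suc n ∈ range (suc n)
∈-range⁺ n = ∈-map⁺ suc (∈-upTo⁺ (s≤s ≤-refl))

Unique-range : ∀ n → Unique (range n)
Unique-range n = Unique.map⁺ suc-injective (Unique.upTo⁺ n)

Unique-resp-↭ : ∀ {l l′ : List ℕ} → l ↭ l′ → Unique l → Unique l′
Unique-resp-↭ p = Permutationₛ.Unique-resp-↭ (setoid ℕ) (↭⇒↭ₛ p)

Missing⇒Unique : ∀ {n m w} → Missing n m w → Unique w
Missing⇒Unique mis with Unique-resp-↭ (↭-sym mis) (Unique-range _)
... | _ ∷ u = u

Unique-++-∷⇒∉ : ∀ (a : List ℕ) {x b} → Unique (a ++ x ∷ b) → x ∉ a
Unique-++-∷⇒∉ (y ∷ a) (y≢ ∷ _) (here refl) = All.lookup y≢ (∈-++⁺ʳ a (here refl)) refl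
Unique-++-∷⇒∉ (y ∷ a) (_ ∷ u)  (there x∈) = Unique-++-∷⇒∉ a u x∈

++-∷-injective : ∀ {x : ℕ} a a′ {b b′} → x ∉ a → x ∉ a′ → a ++ x ∷ b ≡ a′ ++ x ∷ b′ → a ≡ a′ × b ≡ b′
++-∷-injective []      []       _   _    refl = refl , refl
++-∷-injective []      (z ∷ a′) _   x∉a′ e    = ⊥-elim (x∉a′ (here (proj₁ (∷-injective e))))
++-∷-injective (z ∷ a) []       x∉a _    e    = ⊥-elim (x∉a (here (sym (proj₁ (∷-injective e)))))
++-∷-injective (z ∷ a) (z′ ∷ a′) x∉a x∉a′ e with ∷-injective e
... | refl , e′ with ++-∷-injective a a′ (x∉a ∘ there) (x∉a′ ∘ there) e′
... | refl , refl = refl , refl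

IsRotation-from : ∀ {x} a b {t} → Unique (a ++ x ∷ b) → IsRotation (a ++ x ∷ b) (x ∷ t) → t ≡ b ++ a
IsRotation-from {x} a b {t} u (k , e) with iter-rotL-split k (a ++ x ∷ b)
... | [] , d , q≡ , e′
  with ++-∷-injective a [] (Unique-++-∷⇒∉ a u) (λ ()) (trans q≡ (trans (++-identityʳ d) (trans (sym e′) e)))
...   | refl , refl = sym (++-identityʳ b)
IsRotation-from {x} a b {t} u (k , e) | z ∷ c , d , q≡ , e′ with ∷-injective (trans (sym e′) e)
... | refl , t≡
  with ++-∷-injective a d (Unique-++-∷⇒∉ a u) (Unique-++-∷⇒∉ d (subst Unique q≡ u)) q≡
...   | refl , refl = sym t≡

indexOf-++-∷ : ∀ {x} a b → x ∉ a → indexOf x (a ++ x ∷ b) ≡ length a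
indexOf-++-∷ {x} []      b _ with x ≟ x
... | yes _  = refl
... | no x≢x = contradiction refl x≢x
indexOf-++-∷ {x} (z ∷ a) b x∉ with x ≟ z
... | yes x≡z = contradiction (here x≡z) x∉
... | no _    = cong suc (indexOf-++-∷ a b (x∉ ∘ there))

at-++-∷-∷ : ∀ (a : List ℕ) x y l → at (a ++ x ∷ y ∷ l) (suc (length a)) ≡ y
at-++-∷-∷ []      x y l = refl
at-++-∷-∷ (z ∷ a) x y l = at-++-∷-∷ a x y l

≥3-shape : ∀ (y : List ℕ) → 3 ≤ length y → ∃₂ λ a b → ∃₂ λ c t → y ≡ a ∷ b ∷ c ∷ t
≥3-shape (a ∷ b ∷ c ∷ t) _ = a , b , c , t , refl
≥3-shape (_ ∷ [])     (s≤s ())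
≥3-shape (_ ∷ _ ∷ []) (s≤s (s≤s ()))

module RuleSet {n : ℕ} (n≥3 : 3 ≤ n) (cond : List ℕ → Set) (Y : ℕ → ℕ → List ℕ → Set)
  (Y⇒Missing : ∀ {m q} → Y n m q → Missing n m q)
  (Y-rotation : ∀ {m q w} → Y n m q → IsRotation q w → Y n m w)
  (cond⇔Y : ∀ {m w} → Missing n m w → cond (m ∷ w) ⇔ Y n m w) where

  length-IsPerm : ∀ {y} → IsPerm n y → 3 ≤ length y
  length-IsPerm p = subst (3 ≤_) (sym (trans (↭-length p) (length-range n))) n≥3

  IsPerm-shape : ∀ {y} → IsPerm n y → ∃₂ λ a b → ∃₂ λ c t → y ≡ a ∷ b ∷ c ∷ t
  IsPerm-shape p = ≥3-shape _ (length-IsPerm p)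

  τ-arc∉Eσ : ∀ {y} → IsPerm n y → ¬ Eσ n (swap01 y) y
  τ-arc∉Eσ p (_ , e) with IsPerm-shape p
  ... | a , b , c , t , refl with Unique-resp-↭ (↭-sym p) (Unique-range n)
  ... | _ ∷ (b≢c ∷ _) ∷ _ = b≢c (proj₁ (∷-injective (proj₂ (∷-injective e))))

  σ⁻¹-arc∈Eσ : ∀ {y} → IsPerm n y → Eσ n (rotR y) y
  σ⁻¹-arc∈Eσ {y} p = ↭-trans (rotR-↭ y) p , sym (rotL-rotR y)

  cond⇒unionA : ∀ {y} → IsPerm n y → cond y → unionA Y n (swap01 y) y × unionA Y n (rotR y) y
  cond⇒unionA p cy with IsPerm-shape p
  ... | a , b , c , t , refl = (a , b ∷ c ∷ t , yq , swap01∈altCycle n a b (c ∷ t))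
                             , (a , b ∷ c ∷ t , yq , rotR∈altCycle n a b (c ∷ t))
    where
    yq : Y n a (b ∷ c ∷ t)
    yq = to (cond⇔Y p) cy

  unionA-arc : ∀ {x y} → unionA Y n x y →
    ∃₂ λ m w → Y n m w × y ≡ m ∷ w × (x ≡ swap01 (m ∷ w) ⊎ x ≡ rotR (m ∷ w))
  unionA-arc (m , [] , yq , _) with length-IsPerm (Y⇒Missing yq)
  ... | s≤s ()
  unionA-arc (m , c ∷ q , yq , arc) with altCycle-arc {n} arc
  ... | c′ , q′ , ρ , y≡ , x≡ = m , c′ ∷ q′ , Y-rotation yq ρ , y≡ , x≡

  unionA⇒cond : ∀ {x y} → unionA Y n x y → cond y
  unionA⇒cond a with unionA-arc a
  ... | m , w , yw , refl , _ = from (cond⇔Y (Y⇒Missing yw)) yw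

  ruleSet⇔Eσ⊕unionA : ∀ x y → ruleSet cond n x y ⇔ (Eσ n ⊕ unionA Y n) x y
  ruleSet⇔Eσ⊕unionA x y = mk⇔ ⇒ ⇐
    where
    ⇒ : ruleSet cond n x y → (Eσ n ⊕ unionA Y n) x y
    ⇒ (p , inj₁ (cy , refl))  = inj₂ (proj₁ (cond⇒unionA p cy) , τ-arc∉Eσ p)
    ⇒ (p , inj₂ (¬cy , refl)) = inj₁ (σ⁻¹-arc∈Eσ p , ¬cy ∘ unionA⇒cond)
    ⇐ : (Eσ n ⊕ unionA Y n) x y → ruleSet cond n x y
    ⇐ (inj₁ ((px , refl) , ∉A)) = p , inj₂ (¬cy , sym (rotR-rotL x))
      where
      p : IsPerm n (rotL x)
      p = ↭-trans (rotL-↭ x) px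
      ¬cy : ¬ cond (rotL x)
      ¬cy cy = ∉A (subst (λ v → unionA Y n v (rotL x)) (rotR-rotL x) (proj₂ (cond⇒unionA p cy)))
    ⇐ (inj₂ (a , ∉E)) with unionA-arc a
    ... | m , w , yw , refl , inj₁ refl = Y⇒Missing yw , inj₁ (from (cond⇔Y (Y⇒Missing yw)) yw , refl)
    ... | m , w , yw , refl , inj₂ refl = contradiction (σ⁻¹-arc∈Eσ (Y⇒Missing yw)) ∉E

module CyclicSuccessor (k : ℕ) where
  private
    N : ℕ
    N = 3 + k

  N∈tail : ∀ {m w} → Missing N m w → m ≢ N → N ∈ w
  N∈tail mis m≢N with ∈-resp-↭ (↭-sym mis) (∈-range⁺ (2 + k))
  ... | here N≡m  = contradiction (sym N≡m) m≢N
  ... | there N∈w = N∈w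

  -- N sits at index |a| + 1; the index (|a| + 1 mod N - 1) + 1 of r wraps around to 1
  -- exactly when N is the last entry, i.e. when b = [].
  rOf-++-∷ : ∀ m a b {s rest} → N ∉ m ∷ a → length a + length b ≡ suc k → b ++ a ≡ s ∷ rest →
    rOf N (m ∷ a ++ N ∷ b) ≡ s
  rOf-++-∷ m a b {s} N∉ len ba =
    trans (cong (λ i → at (m ∷ a ++ N ∷ b) (suc (i % suc (suc k)))) (indexOf-++-∷ (m ∷ a) b N∉))
          (go b len ba)
    where
    open ≡-Reasoning
    go : ∀ b {rest} → length a + length b ≡ suc k → b ++ a ≡ s ∷ rest →
      at (m ∷ a ++ N ∷ b) (suc (suc (length a) % suc (suc k))) ≡ s
    go [] len ba = begin
      at (m ∷ a ++ [ N ]) (suc (suc (length a) % suc (suc k))) ≡⟨ cong (λ i → at (m ∷ a ++ [ N ]) (suc i)) wrap ⟩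
      at (m ∷ a ++ [ N ]) 1                                   ≡⟨ cong (λ v → at (m ∷ v ++ [ N ]) 1) ba ⟩
      s                                                       ∎
      where
      wrap : suc (length a) % suc (suc k) ≡ 0
      wrap = trans (cong (λ L → suc L % suc (suc k)) (trans (sym (+-identityʳ (length a))) len)) (n%n≡0 (suc (suc k)))
    go (z ∷ b) len ba = begin
      at (m ∷ a ++ N ∷ z ∷ b) (suc (suc (length a) % suc (suc k))) ≡⟨ cong (λ i → at (m ∷ a ++ N ∷ z ∷ b) (suc i)) no-wrap ⟩
      at (a ++ N ∷ z ∷ b) (suc (length a))                         ≡⟨ at-++-∷-∷ a N z b ⟩
      z                                                            ≡⟨ proj₁ (∷-injective ba) ⟩
      s                                                            ∎
      where
      no-wrap : suc (length a) % suc (suc k) ≡ suc (length a)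
      no-wrap = m<n⇒m%n≡m (s≤s (subst (length a <_) len (m<m+n (length a) (s≤s z≤n))))

  length-split : ∀ {m} a b → Missing N m (a ++ N ∷ b) → length a + length b ≡ suc k
  length-split a b mis = suc-injective (suc-injective (begin
    suc (suc (length a + length b)) ≡⟨ cong suc (+-suc (length a) (length b)) ⟨
    suc (length a + suc (length b)) ≡⟨ cong suc (length-++ a) ⟨
    suc (length (a ++ N ∷ b))       ≡⟨ ↭-length mis ⟩
    length (range N)                ≡⟨ length-range N ⟩
    N                               ∎))
    where open ≡-Reasoning

  InR⇔rOf≡ : ∀ {m w r} → Missing N m w → m ≢ N → InR N r m w ⇔ rOf N (m ∷ w) ≡ r
  InR⇔rOf≡ {m} {r = r} mis m≢N with ∈-∃++ (N∈tail mis m≢N)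
  ... | a , b , refl with b ++ a in ba
  ...   | [] = contradiction (trans (sym (cong length ba)) length[b++a]) λ ()
    where
    length[b++a] : length (b ++ a) ≡ suc k
    length[b++a] = trans (length-++ b) (trans (+-comm (length b) (length a)) (length-split a b mis))
  ...   | s ∷ rest = mk⇔
    (λ (_ , rest′ , ρ) → trans rOf≡s (sym (proj₁ (∷-injective (trans (IsRotation-from a b u ρ) ba)))))
    (λ rOf≡r → mis , rest , subst (λ v → IsRotation (a ++ N ∷ b) (N ∷ v ∷ rest)) (trans (sym rOf≡s) rOf≡r) ρ)
    where
    u : Unique (a ++ N ∷ b)
    u = Missing⇒Unique mis
    N∉m∷a : N ∉ m ∷ a
    N∉m∷a (here N≡m)  = m≢N (sym N≡m)
    N∉m∷a (there N∈a) = Unique-++-∷⇒∉ a u N∈a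
    rOf≡s : rOf N (m ∷ a ++ N ∷ b) ≡ s
    rOf≡s = rOf-++-∷ m a b N∉m∷a (length-split a b mis) ba
    ρ : IsRotation (a ++ N ∷ b) (N ∷ s ∷ rest)
    ρ = subst (IsRotation (a ++ N ∷ b) ∘ (N ∷_)) ba (IsRotation-++ a (N ∷ b))

  rOf∈tail : ∀ {m w} → Missing N m w → m ≢ N → rOf N (m ∷ w) ∈ w
  rOf∈tail mis m≢N with from (InR⇔rOf≡ mis m≢N) refl
  ... | _ , _ , ρ = ∈-resp-↭ (IsRotation⇒↭ ρ) (there (here refl))

  chainClause⇔InChain : ∀ {m w} → Missing N m w →
    (rOf N (m ∷ w) < N ∸ 1 × rOf N (m ∷ w) ≡ m ∸ 1) ⇔ InChain N m w
  chainClause⇔InChain {m} {w} mis with m ≟ N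
  ... | yes refl = mk⇔
    (λ (r< , r≡) → contradiction r< (<-irrefl r≡))
    (λ (_ , _ , r≤ , N≡ , _) → contradiction (subst (_≤ 2 + k) (sym N≡) (s≤s r≤)) (n≮n (2 + k)))
  ... | no m≢N = mk⇔ ⇒ ⇐
    where
    r : ℕ
    r = rOf N (m ∷ w)
    ⇒ : r < N ∸ 1 × r ≡ m ∸ 1 → InChain N m w
    ⇒ (r< , r≡) = r , 1≤r , ≤-pred r< , m≡suc[r] 1≤m r≡ , from (InR⇔rOf≡ mis m≢N) refl
      where
      1≤m : 1 ≤ m
      1≤m = proj₁ (∈-range⁻ (∈-resp-↭ mis (here refl)))
      1≤r : 1 ≤ r
      1≤r = proj₁ (∈-range⁻ (∈-resp-↭ mis (there (rOf∈tail mis m≢N))))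
      m≡suc[r] : ∀ {m} → 1 ≤ m → r ≡ m ∸ 1 → m ≡ suc r
      m≡suc[r] {suc _} _ refl = refl
    ⇐ : InChain N m w → r < N ∸ 1 × r ≡ m ∸ 1
    ⇐ (r′ , _ , r′≤ , refl , inR) = subst (_< N ∸ 1) (sym r≡r′) (s≤s r′≤) , r≡r′
      where
      r≡r′ : r ≡ r′
      r≡r′ = to (InR⇔rOf≡ mis m≢N) inR

  successorClause⇔InR : ∀ {m w c r} → c ≢ N → Missing N m w → (rOf N (m ∷ w) ≡ r × m ≡ c) ⇔ (m ≡ c × InR N r c w)
  successorClause⇔InR c≢N mis = mk⇔
    (λ { (r≡ , refl) → refl , from (InR⇔rOf≡ mis c≢N) r≡ })
    (λ { (refl , inR) → to (InR⇔rOf≡ mis c≢N) inR , refl })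

  rotationClause⇔ : ∀ {m w} → Missing N m w →
    IsRotation (range (N ∸ 1)) w ⇔ (m ≡ N × Missing N N w × IsRotation (range (N ∸ 1)) w)
  rotationClause⇔ {m} {w} mis = mk⇔ ⇒ (proj₂ ∘ proj₂)
    where
    ⇒ : IsRotation (range (N ∸ 1)) w → m ≡ N × Missing N N w × IsRotation (range (N ∸ 1)) w
    ⇒ ρ with m ≟ N
    ... | yes refl = refl , mis , ρ
    ... | no m≢N  = contradiction (proj₂ (∈-range⁻ (∈-resp-↭ (IsRotation⇒↭ ρ) (N∈tail mis m≢N)))) (n≮n (2 + k))

  condC⇔InYC : ∀ {m w} → Missing N m w → condC N (m ∷ w) ⇔ InYC N m w
  condC⇔InYC mis = chainClause⇔InChain mis ⊎-⇔ successorClause⇔InR (λ ()) mis ⊎-⇔ rotationClause⇔ mis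

  condD⇔InYD : ∀ {m w} → Missing N m w → condD N (m ∷ w) ⇔ InYD N m w
  condD⇔InYD mis = chainClause⇔InChain mis ⊎-⇔ successorClause⇔InR (λ ()) mis

Missing-rotation : ∀ {n m q w} → Missing n m q → IsRotation q w → Missing n m w
Missing-rotation {m = m} mis ρ = ↭-trans (prep m (IsRotation⇒↭ ρ)) mis

InR-rotation : ∀ {n r m q w} → InR n r m q → IsRotation q w → InR n r m w
InR-rotation (mis , rest , ρ′) ρ = Missing-rotation mis ρ , rest , IsRotation-trans (IsRotation-sym ρ) ρ′

InYC-rotation : ∀ {n m q w} → InYC n m q → IsRotation q w → InYC n m w
InYC-rotation (inj₁ (r , 1≤r , r≤ , m≡ , inR)) ρ = inj₁ (r , 1≤r , r≤ , m≡ , InR-rotation inR ρ)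
InYC-rotation (inj₂ (inj₁ (m≡ , inR)))         ρ = inj₂ (inj₁ (m≡ , InR-rotation inR ρ))
InYC-rotation (inj₂ (inj₂ (m≡ , mis , ρ′)))    ρ = inj₂ (inj₂ (m≡ , Missing-rotation mis ρ , IsRotation-trans ρ′ ρ))

InYD-rotation : ∀ {n m q w} → InYD n m q → IsRotation q w → InYD n m w
InYD-rotation (inj₁ (r , 1≤r , r≤ , m≡ , inR)) ρ = inj₁ (r , 1≤r , r≤ , m≡ , InR-rotation inR ρ)
InYD-rotation (inj₂ (m≡ , inR))                ρ = inj₂ (m≡ , InR-rotation inR ρ)

InYC⇒Missing : ∀ {n m q} → InYC n m q → Missing n m q
InYC⇒Missing (inj₁ (_ , _ , _ , _ , mis , _))  = mis
InYC⇒Missing (inj₂ (inj₁ (refl , mis , _)))    = mis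
InYC⇒Missing (inj₂ (inj₂ (refl , mis , _)))    = mis

InYD⇒Missing : ∀ {n m q} → InYD n m q → Missing n m q
InYD⇒Missing (inj₁ (_ , _ , _ , _ , mis , _)) = mis
InYD⇒Missing (inj₂ (refl , mis , _))          = mis

lemma5 : (n : ℕ) → 3 ≤ n →
    ((x y : List ℕ) → Cn n x y ⇔ (Eσ n ⊕ AC n) x y)
    × ((x y : List ℕ) → Dn n x y ⇔ (Eσ n ⊕ AD n) x y)
lemma5 (suc (suc (suc k))) n≥3@(s≤s (s≤s (s≤s _))) =
  RuleSet.ruleSet⇔Eσ⊕unionA n≥3 _ InYC InYC⇒Missing InYC-rotation condC⇔InYC ,
  RuleSet.ruleSet⇔Eσ⊕unionA n≥3 _ InYD InYD⇒Missing InYD-rotation condD⇔InYD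
  where open CyclicSuccessor k
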